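{- For all integers $n\ge 0$ and $m>1$, $sp(n,m)=oc(n,m)$.
   Context: Fix $m>1$. Semi-$m$-Pell compositions: $SP(n,m)=\{(n)\}$ for $1\le n\le m$; if $n>m$ and $m\mid n$, $SP(n,m)$ consists of the compositions in $SP(n/m,m)$ with every part multiplied by $m$; if $n>m$ and $n\equiv r\pmod m$, $1\le r\le m-1$, $SP(n,m)$ consists of the compositions obtained by inserting a part $r$ at the beginning or end of each composition in $SP(n-r,m)$, together with those obtained from each composition in $SP(n-m,m)$ by adding $m$ to its (unique) part congruent to $r$ mod $m$. Let $sp(n,m)=|SP(n,m)|$ for $n\ge1$ and $sp(0,m)=1$; equivalently $sp(0,m)=1$, $sp(n,m)=1$ for $1\le n\le m-1$, and for $n\ge m$: $sp(n,m)=sp(n/m,m)$ if $m\mid n$, and $sp(n,m)=2sp(n-r,m)+sp(n-m,m)$ if $n\equiv r\pmod m$, $0<r<m$. $oc(n,m)$ is the number of weakly unimodal compositions of $n$ into powers of $m$ in which every part size that occurs appears in a single block of consecutive positions with multiplicity not divisible by $m$ ($oc(0,m)=1$). A composition is weakly unimodal if it has the form $(a_1,\dots,a_r,c,b_s,\dots,b_1)$ with $a_1\le\cdots\le a_r\le c>b_s\ge\cdots\ge b_1\ge1$ (the $a$'s or $b$'s may be absent). -}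

module Defs where

open import Data.Nat using (ℕ; zero; suc; _+_; _*_; _∸_; _^_; _≤_; _<_; _≥_; _>_; _<ᵇ_; _≡ᵇ_)
open import Data.Nat.DivMod using (_/_; _%_)
open import Data.Nat.Divisibility using (_∣_)
open import Data.Bool using (if_then_else_)
open import Data.List using (List; []; _∷_; _++_; length; replicate)
open import Data.Nat.ListAction using (sum)
open import Data.List.Relation.Unary.All using (All)
open import Data.List.Relation.Unary.Linked using (Linked)
open import Data.List.Relation.Unary.Unique.Propositional using (Unique)
open import Data.List.Membership.Propositional using (_∈_; _∉_)
open import Data.Product using (Σ; ∃; _×_)
open import Data.Sum using (_⊎_)
open import Data.Unit using (⊤)
open import Relation.Nullary using (¬_)
open import Relation.Binary.PropositionalEquality using (_≡_)

-- sp(n,m), via the recurrence: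
--   sp(0,m)=1, sp(n,m)=1 for 1 ≤ n ≤ m-1, and for n ≥ m:
--   sp(n,m)=sp(n/m,m) if m ∣ n,
--   sp(n,m)=2 sp(n-r,m)+sp(n-m,m) if n ≡ r (mod m), 0<r<m.
-- Implemented with a fuel argument (each recursive call strictly
-- decreases n when m ≥ 2, so fuel n suffices).  The divisor is
-- written as suc (suc k) = m ≥ 2; for m ≤ 1 the value is irrelevant.

spF : ℕ → ℕ → ℕ → ℕ
spF zero    n k = 1
spF (suc f) n k =
  if n <ᵇ m then 1
  else if (n % m) ≡ᵇ 0 then spF f (n / m) k
  else 2 * spF f (n ∸ (n % m)) k + spF f (n ∸ m) k
  where m = suc (suc k)

sp : ℕ → ℕ → ℕ
sp n zero          = 1
sp n (suc zero)    = 1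
sp n (suc (suc k)) = spF n n k

IsComposition : ℕ → List ℕ → Set
IsComposition n c = All (λ x → 1 ≤ x) c × sum c ≡ n

IsPowerOf : ℕ → ℕ → Set
IsPowerOf m p = ∃ λ k → m ^ k ≡ p

AboveHead : ℕ → List ℕ → Set
AboveHead x []      = ⊤
AboveHead x (b ∷ _) = b < x

-- Weakly unimodal: (a₁,…,a_r,c,b_s,…,b₁) with
-- a₁ ≤ … ≤ a_r ≤ c > b_s ≥ … ≥ b₁ (here bs = b_s ∷ … ∷ b₁),
-- or the empty composition.
WeaklyUnimodal : List ℕ → Set
WeaklyUnimodal c =
  c ≡ [] ⊎
  Σ (List ℕ) λ as → Σ ℕ λ x → Σ (List ℕ) λ bs →
    c ≡ as ++ (x ∷ bs) × Linked _≤_ (as ++ (x ∷ [])) ×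
    AboveHead x bs × Linked _≥_ bs

SingleBlocks : ℕ → List ℕ → Set
SingleBlocks m c =
  ∀ x → x ∈ c →
    Σ (List ℕ) λ pre → Σ ℕ λ k → Σ (List ℕ) λ post →
      c ≡ pre ++ (replicate k x ++ post) × x ∉ pre × x ∉ post × ¬ (m ∣ k)

OC : ℕ → ℕ → List ℕ → Set
OC n m c = IsComposition n c × All (IsPowerOf m) c × WeaklyUnimodal c × SingleBlocks m c

HasCardinality : (List ℕ → Set) → ℕ → Set
HasCardinality P k =
  Σ (List (List ℕ)) λ L →
    Unique L × (∀ c → c ∈ L → P c) × (∀ c → P c → c ∈ L) × length L ≡ k

module Submission where

-- A weakly unimodal composition in which every part size occupies a single block
-- is "layered": it arises from the empty composition by repeatedly putting, at its left or
-- right end, a block of a new part size smaller than all parts present, with multiplicity not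
-- divisible by m (peel off the block of the minimum, which must sit at an end).  For
-- compositions of n into powers of m the outermost layer is the block of 1s, if there are any.
-- If m ∣ n there are none, and dividing all parts by m is a bijection onto the compositions of
-- n / m.  Otherwise the 1-block, at the left or the right end, has a length j ≡ r = n mod m:
-- if j = r, removing it leaves a composition of n - r without 1s; if j > m, shortening it by m
-- leaves a composition of n - m.  This gives sp(n) = 2 sp(n - r) + sp(n - m), realised by an
-- explicit duplicate-free enumeration.

open import Defs
open import Data.Nat using (ℕ; zero; suc; _+_; _*_; _∸_; _^_; _≤_; _<_; _≥_; z≤n; s≤s; z<s; NonZero; >-nonZero; ≢-nonZero; _<ᵇ_; _≡ᵇ_)
open import Data.Nat.Properties using (_≟_; _≤?_; _<?_; ≤-refl; ≤-trans; <-trans; <-irrefl; <⇒≤; <⇒≱; ≰⇒>; ≮⇒≥; >⇒≢; ≤∧≢⇒<; <-≤-trans; ≤-<-trans; m<1+n⇒m≤n; m≤m+n; m≤n+m; +-comm; +-assoc; +-identityʳ; *-comm; *-zeroʳ; *-distribˡ-+; *-monoʳ-<; *-cancelˡ-<; *-cancelˡ-≡; m≤m*n; m^n>0; m^n≢0; m+n∸m≡n; m+[n∸m]≡n; m∸n≡0⇒m≤n; ∸-monoʳ-<; m≤n⇒∃[o]m+o≡n; <ᵇ-reflects-<; ≡ᵇ⇒≡; ≡⇒≡ᵇ)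
open import Data.Nat.DivMod using (_/_; _%_; m≡m%n+[m/n]*n; m%n<n; m%n≤m; m<n⇒m%n≡m; %-remove-+ʳ; m*n/n≡m; m*[n/m]≡n; m/n<m)
open import Data.Nat.Divisibility using (_∣_; divides; _∣0; ∣m∣n⇒∣m+n; ∣m+n∣m⇒∣n; n∣n; m∣m*n; >⇒∤; m%n≡0⇒n∣m; n∣m⇒m%n≡0)
open import Data.Nat.ListAction using (sum)
open import Data.Nat.ListAction.Properties using (sum-++)
open import Data.Nat.Induction using (<-wellFounded)
open import Data.Bool using (true; false; if_then_else_)
open import Data.List using (List; []; _∷_; _++_; [_]; _∷ʳ_; length; replicate; map; filter; initLast; _∷ʳ′_)
open import Data.List.Properties using (++-assoc; ++-identityʳ; ++-cancelˡ; ++-cancelʳ; ∷-injective; ∷-injectiveˡ; ∷-injectiveʳ; ∷ʳ-injectiveʳ; map-++; map-replicate; map-∘; map-id-local; map-injective; length-++; length-map; length-replicate; filter-++; filter-all; filter-none)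
open import Data.List.Relation.Unary.All as All using (All; []; _∷_)
import Data.List.Relation.Unary.All.Properties as All
open import Data.List.Relation.Unary.Any using (here; there)
open import Data.List.Relation.Unary.AllPairs as AllPairs using (AllPairs; []; _∷_)
import Data.List.Relation.Unary.AllPairs.Properties as AllPairs
open import Data.List.Relation.Unary.Linked using ([])
import Data.List.Relation.Unary.Linked.Properties as Linked
open import Data.List.Relation.Unary.Unique.Propositional using (Unique)
import Data.List.Relation.Unary.Unique.Propositional.Properties as Unique
open import Data.List.Membership.Propositional using (_∈_; _∉_)
open import Data.List.Membership.Propositional.Properties using (∈-++⁺ˡ; ∈-++⁺ʳ; ∈-++⁻; ∈-map⁺; ∈-map⁻)
open import Data.List.Relation.Binary.Disjoint.Propositional using (Disjoint)
import Data.List.Relation.Binary.Disjoint.Propositional.Properties as Disjoint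
open import Data.Product using (∃; ∃₂; _×_; _,_; proj₁; proj₂)
open import Data.Sum using (_⊎_; inj₁; inj₂)
open import Data.Unit using (⊤; tt)
open import Data.Empty using (⊥-elim)
open import Function using (_∘_)
open import Induction.WellFounded using (Acc; acc)
open import Relation.Nullary using (¬_; yes; no)
open import Relation.Nullary.Reflects using (Reflects; ofʸ; ofⁿ; fromEquivalence)
open import Relation.Binary.PropositionalEquality using (_≡_; refl; sym; trans; cong; cong₂; subst; subst₂; _≢_; module ≡-Reasoning)


m<n≤1+o⇒m≤o : ∀ {m n o} → m < n → n ≤ suc o → m ≤ o
m<n≤1+o⇒m≤o m<n n≤1+o = m<1+n⇒m≤n (<-≤-trans m<n n≤1+o)

≡ᵇ-reflects-≡ : ∀ m n → Reflects (m ≡ n) (m ≡ᵇ n)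
≡ᵇ-reflects-≡ m n = fromEquivalence (≡ᵇ⇒≡ m n) (≡⇒≡ᵇ m n)

[j+s]%m≡j : ∀ {m j s} .{{_ : NonZero m}} → m ∣ s → j < m → (j + s) % m ≡ j
[j+s]%m≡j {j = j} m∣s j<m = trans (%-remove-+ʳ j m∣s) (m<n⇒m%n≡m j<m)

m∤j⇒m∤m+j : ∀ {m j} → ¬ m ∣ j → ¬ m ∣ m + j
m∤j⇒m∤m+j m∤j m∣m+j = m∤j (∣m+n∣m⇒∣n m∣m+j n∣n)

module _ {A : Set} where

  ∈-replicate⁻ : ∀ {x y : A} k → y ∈ replicate k x → y ≡ x
  ∈-replicate⁻ (suc k) (here y≡x)  = y≡x
  ∈-replicate⁻ (suc k) (there y∈) = ∈-replicate⁻ k y∈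

  replicate-++ : ∀ (x : A) i j → replicate i x ++ replicate j x ≡ replicate (i + j) x
  replicate-++ x zero    j = refl
  replicate-++ x (suc i) j = cong (x ∷_) (replicate-++ x i j)

  replicate-++-∷ : ∀ (x : A) k s → replicate k x ++ x ∷ s ≡ x ∷ replicate k x ++ s
  replicate-++-∷ x zero    s = refl
  replicate-++-∷ x (suc k) s = cong (x ∷_) (replicate-++-∷ x k s)

  ++-replicate-∷ : ∀ pre (x : A) k post →
                   (pre ++ replicate k x) ++ x ∷ post ≡ pre ++ replicate (suc k) x ++ post
  ++-replicate-∷ pre x k post = trans (++-assoc pre _ _) (cong (pre ++_) (replicate-++-∷ x k post))

  ∉⇒Disjoint-replicate : ∀ {x : A} k {c} → x ∉ c → Disjoint (replicate k x) c
  ∉⇒Disjoint-replicate k x∉c (y∈ , y∈c) = x∉c (subst (_∈ _) (∈-replicate⁻ k y∈) y∈c)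

  ++-equidivisible : ∀ (a b c d : List A) → a ++ b ≡ c ++ d →
    (∃ λ e → c ≡ a ++ e × b ≡ e ++ d) ⊎ (∃ λ e → a ≡ c ++ e × d ≡ e ++ b)
  ++-equidivisible []      b c       d eq = inj₁ (c , refl , eq)
  ++-equidivisible (x ∷ a) b []      d eq = inj₂ (x ∷ a , refl , sym eq)
  ++-equidivisible (x ∷ a) b (y ∷ c) d eq with ∷-injective eq
  ... | refl , eq′ with ++-equidivisible a b c d eq′
  ...   | inj₁ (e , c≡ , b≡) = inj₁ (e , cong (x ∷_) c≡ , b≡)
  ...   | inj₂ (e , a≡ , d≡) = inj₂ (e , cong (x ∷_) a≡ , d≡)

  ∉-prefix : ∀ {y : A} p {q} pre {s} → p ++ q ≡ pre ++ y ∷ s → y ∉ p →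
             ∃ λ pre′ → pre ≡ p ++ pre′
  ∉-prefix []      pre       eq y∉p = pre , refl
  ∉-prefix (x ∷ p) []        eq y∉p = ⊥-elim (y∉p (here (sym (∷-injectiveˡ eq))))
  ∉-prefix (x ∷ p) (z ∷ pre) eq y∉p with ∉-prefix p pre (∷-injectiveʳ eq) (y∉p ∘ there)
  ... | pre′ , refl = pre′ , cong (_∷ _) (sym (∷-injectiveˡ eq))

  ∉-suffix : ∀ {y : A} u {s} p {q} → u ++ y ∷ s ≡ p ++ q → y ∉ q →
             ∃ λ s′ → s ≡ s′ ++ q
  ∉-suffix []      []      eq y∉q = ⊥-elim (y∉q (subst (_ ∈_) eq (here refl)))
  ∉-suffix []      (x ∷ p) eq y∉q = p , ∷-injectiveʳ eq
  ∉-suffix (z ∷ u) []      eq y∉q = ⊥-elim (y∉q (subst (_ ∈_) eq (there (∈-++⁺ʳ u (here refl)))))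
  ∉-suffix (z ∷ u) (x ∷ p) eq y∉q = ∉-suffix u p (∷-injectiveʳ eq) y∉q

data Side : Set where
  left right : Side

attach : ∀ {A : Set} → Side → List A → List A → List A
attach left  b c = b ++ c
attach right b c = c ++ b

module _ {A : Set} where

  ∈-attach⁺ʳ : ∀ s {y : A} b {c} → y ∈ c → y ∈ attach s b c
  ∈-attach⁺ʳ left  b y∈c = ∈-++⁺ʳ b y∈c
  ∈-attach⁺ʳ right b y∈c = ∈-++⁺ˡ y∈c

  ∈-attach⁻ : ∀ s {y : A} b c → y ∈ attach s b c → y ∈ b ⊎ y ∈ c
  ∈-attach⁻ left  b c y∈ = ∈-++⁻ b y∈
  ∈-attach⁻ right b c y∈ with ∈-++⁻ c y∈
  ... | inj₁ y∈c = inj₂ y∈c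
  ... | inj₂ y∈b = inj₁ y∈b

  module _ {P : A → Set} where

    All-attach⁺ : ∀ s {b c} → All P b → All P c → All P (attach s b c)
    All-attach⁺ left  pb pc = All.++⁺ pb pc
    All-attach⁺ right pb pc = All.++⁺ pc pb

    All-attach⁻ : ∀ s b {c} → All P (attach s b c) → All P b × All P c
    All-attach⁻ left  b      p = All.++⁻ b p
    All-attach⁻ right b {c}  p = proj₂ (All.++⁻ c p) , proj₁ (All.++⁻ c p)

  attach-cancel : ∀ s (b : List A) {c d} → attach s b c ≡ attach s b d → c ≡ d
  attach-cancel left  b eq = ++-cancelˡ b _ _ eq
  attach-cancel right b eq = ++-cancelʳ b _ _ eq

  length-attach : ∀ s (b c : List A) → length (attach s b c) ≡ length b + length c
  length-attach left  b c = length-++ b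
  length-attach right b c = trans (length-++ c) (+-comm (length c) _)

map-attach : ∀ {A B : Set} (f : A → B) s b c → map f (attach s b c) ≡ attach s (map f b) (map f c)
map-attach f left  b c = map-++ f b c
map-attach f right b c = map-++ f c b

module _ {R : ℕ → ℕ → Set} where

  AllPairs-++⁻ : ∀ xs {ys} → AllPairs R (xs ++ ys) →
                 AllPairs R xs × AllPairs R ys × All (λ x → All (R x) ys) xs
  AllPairs-++⁻ []       p          = [] , p , []
  AllPairs-++⁻ (x ∷ xs) (px ∷ p) with AllPairs-++⁻ xs p
  ... | pxs , pys , pxsys = All.++⁻ˡ xs px ∷ pxs , pys , All.++⁻ʳ xs px ∷ pxsys

  AllPairs-replicate : ∀ {x} k → R x x → AllPairs R (replicate k x)
  AllPairs-replicate zero    r = []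
  AllPairs-replicate (suc k) r = All.replicate⁺ k r ∷ AllPairs-replicate k r

  AllPairs-∷ʳ⁺ : ∀ {xs y} → AllPairs R xs → All (λ x → R x y) xs → AllPairs R (xs ∷ʳ y)
  AllPairs-∷ʳ⁺ rxs rxsy = AllPairs.++⁺ rxs ([] ∷ []) (All.map (_∷ []) rxsy)

  AllPairs-∷ʳ⁻ : ∀ xs {y} → AllPairs R (xs ∷ʳ y) → All (λ x → R x y) xs
  AllPairs-∷ʳ⁻ xs rxsy = All.map (λ { (rxy ∷ []) → rxy }) (proj₂ (proj₂ (AllPairs-++⁻ xs rxsy)))

data Layered (m : ℕ) : List ℕ → Set where
  []    : Layered m []
  layer : ∀ s {x k c} → ¬ m ∣ k → All (x <_) c → Layered m c →
          Layered m (attach s (replicate k x) c)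

module _ {m : ℕ} where

  SingleBlocks-replicate : ∀ x {k} → ¬ m ∣ k → SingleBlocks m (replicate k x)
  SingleBlocks-replicate x {k} m∤k y y∈ rewrite ∈-replicate⁻ k y∈ =
    [] , k , [] , sym (++-identityʳ _) , (λ ()) , (λ ()) , m∤k

  SingleBlocks-++⁺ : ∀ {p q} → Disjoint p q →
                     SingleBlocks m p → SingleBlocks m q → SingleBlocks m (p ++ q)
  SingleBlocks-++⁺ {p} {q} p#q sbp sbq y y∈ with ∈-++⁻ p y∈
  ... | inj₁ y∈p with sbp y y∈p
  ...   | pre , k , post , refl , y∉pre , y∉post , m∤k =
    pre , k , post ++ q ,
    trans (++-assoc pre _ q) (cong (pre ++_) (++-assoc (replicate k y) post q)) ,
    y∉pre , y∉post++q , m∤k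
    where
      y∉post++q : y ∉ post ++ q
      y∉post++q y∈′ with ∈-++⁻ post y∈′
      ... | inj₁ y∈post = y∉post y∈post
      ... | inj₂ y∈q    = p#q (y∈p , y∈q)
  SingleBlocks-++⁺ {p} {q} p#q sbp sbq y y∈ | inj₂ y∈q with sbq y y∈q
  ...   | pre , k , post , refl , y∉pre , y∉post , m∤k =
    p ++ pre , k , post , sym (++-assoc p pre _) , y∉p++pre , y∉post , m∤k
    where
      y∉p++pre : y ∉ p ++ pre
      y∉p++pre y∈′ with ∈-++⁻ p y∈′
      ... | inj₁ y∈p   = p#q (y∈p , y∈q)
      ... | inj₂ y∈pre = y∉pre y∈pre

  SingleBlocks-++⁻ʳ : ∀ {p q} → Disjoint p q → SingleBlocks m (p ++ q) → SingleBlocks m q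
  SingleBlocks-++⁻ʳ {p} {q} p#q sb y y∈q with sb y (∈-++⁺ʳ p y∈q)
  ... | pre , zero , post , _ , _ , _ , m∤0 = ⊥-elim (m∤0 (m ∣0))
  ... | pre , suc k , post , eq , y∉pre , y∉post , m∤k
      with ∉-prefix p pre eq (λ y∈p → p#q (y∈p , y∈q))
  ...   | pre′ , refl =
    pre′ , suc k , post , ++-cancelˡ p _ _ (trans eq (++-assoc p pre′ _)) ,
    y∉pre ∘ ∈-++⁺ʳ p , y∉post , m∤k

  SingleBlocks-++⁻ˡ : ∀ {p q} → Disjoint p q → SingleBlocks m (p ++ q) → SingleBlocks m p
  SingleBlocks-++⁻ˡ {p} {q} p#q sb y y∈p with sb y (∈-++⁺ˡ y∈p)
  ... | pre , zero , post , _ , _ , _ , m∤0 = ⊥-elim (m∤0 (m ∣0))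
  ... | pre , suc k , post , eq , y∉pre , y∉post , m∤k
      with ∉-suffix (pre ++ replicate k y) p (trans (++-replicate-∷ pre y k post) (sym eq))
                    (λ y∈q → p#q (y∈p , y∈q))
  ...   | post′ , refl =
    pre , suc k , post′ ,
    ++-cancelʳ q _ _ (trans eq (sym (trans (++-assoc pre _ q)
                                 (cong (pre ++_) (++-assoc (replicate (suc k) y) post′ q))))) ,
    y∉pre , y∉post ∘ ∈-++⁺ˡ , m∤k

  SingleBlocks-attach⁺ : ∀ s {b c} → Disjoint b c →
                         SingleBlocks m b → SingleBlocks m c → SingleBlocks m (attach s b c)
  SingleBlocks-attach⁺ left  b#c sbb sbc = SingleBlocks-++⁺ b#c sbb sbc
  SingleBlocks-attach⁺ right b#c sbb sbc = SingleBlocks-++⁺ (Disjoint.sym b#c) sbc sbb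

  SingleBlocks-attach⁻ : ∀ s {b c} → Disjoint b c → SingleBlocks m (attach s b c) → SingleBlocks m c
  SingleBlocks-attach⁻ left  b#c sb = SingleBlocks-++⁻ʳ b#c sb
  SingleBlocks-attach⁻ right b#c sb = SingleBlocks-++⁻ˡ (Disjoint.sym b#c) sb

below⇒∉ : ∀ {x c} → All (x <_) c → x ∉ c
below⇒∉ x<c x∈c = <-irrefl refl (All.lookup x<c x∈c)

layered⇒singleBlocks : ∀ {m c} → Layered m c → SingleBlocks m c
layered⇒singleBlocks []                                = λ _ ()
layered⇒singleBlocks (layer s {x} {k} m∤k x<c layered) =
  SingleBlocks-attach⁺ s (∉⇒Disjoint-replicate k (below⇒∉ x<c))
    (SingleBlocks-replicate x m∤k) (layered⇒singleBlocks layered)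

Mountain : List ℕ → Set
Mountain c = ∃₂ λ as bs → c ≡ as ++ bs × AllPairs _≤_ as × AllPairs _≥_ bs

weaklyUnimodal⇒mountain : ∀ {c} → WeaklyUnimodal c → Mountain c
weaklyUnimodal⇒mountain (inj₁ refl) = [] , [] , refl , [] , []
weaklyUnimodal⇒mountain (inj₂ (as , x , bs , refl , as≤x , _ , bs≥)) =
  as ++ [ x ] , bs , sym (++-assoc as [ x ] bs) ,
  Linked.Linked⇒AllPairs ≤-trans as≤x , Linked.Linked⇒AllPairs (λ p q → ≤-trans q p) bs≥

-- Keep climbing while the next part is not smaller; the first descent marks the peak.
climb : ∀ as y bs → AllPairs _≤_ as → All (_≤ y) as → AllPairs _≥_ bs →
        WeaklyUnimodal (as ++ y ∷ bs)
climb as y []       as≤ as≤y _ =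
  inj₂ (as , y , [] , refl , Linked.AllPairs⇒Linked (AllPairs-∷ʳ⁺ as≤ as≤y) , tt , [])
climb as y (b ∷ bs) as≤ as≤y bs≥@(_ ∷ bs≥′) with y ≤? b
... | yes y≤b =
  subst WeaklyUnimodal (++-assoc as [ y ] (b ∷ bs))
    (climb (as ∷ʳ y) b bs (AllPairs-∷ʳ⁺ as≤ as≤y)
           (All.∷ʳ⁺ (All.map (λ z≤y → ≤-trans z≤y y≤b) as≤y) y≤b) bs≥′)
... | no y≰b =
  inj₂ (as , y , b ∷ bs , refl , Linked.AllPairs⇒Linked (AllPairs-∷ʳ⁺ as≤ as≤y) ,
        ≰⇒> y≰b , Linked.AllPairs⇒Linked bs≥)

mountain⇒weaklyUnimodal : ∀ {c} → Mountain c → WeaklyUnimodal c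
mountain⇒weaklyUnimodal (as , bs , refl , as≤ , bs≥) with initLast as
mountain⇒weaklyUnimodal (_ , [] , refl , _ , _)            | [] = inj₁ refl
mountain⇒weaklyUnimodal (_ , b ∷ bs , refl , _ , _ ∷ bs≥) | [] = climb [] b bs [] [] bs≥
mountain⇒weaklyUnimodal (_ , bs , refl , as≤ , bs≥) | as ∷ʳ′ y =
  subst WeaklyUnimodal (sym (++-assoc as [ y ] bs)) (climb as y bs as≤′ as≤y bs≥)
  where
    as≤′ : AllPairs _≤_ as
    as≤′ = proj₁ (AllPairs-++⁻ as as≤)
    as≤y : All (_≤ y) as
    as≤y = AllPairs-∷ʳ⁻ as as≤

mountain-++⁻ʳ : ∀ b {c} → Mountain (b ++ c) → Mountain c
mountain-++⁻ʳ b {c} (as , bs , eq , as≤ , bs≥) with ++-equidivisible b c as bs eq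
... | inj₁ (e , refl , refl) = e , bs , refl , proj₁ (proj₂ (AllPairs-++⁻ b as≤)) , bs≥
... | inj₂ (e , _ , refl)    = [] , c , refl , [] , proj₁ (proj₂ (AllPairs-++⁻ e bs≥))

mountain-++⁻ˡ : ∀ b {c} → Mountain (c ++ b) → Mountain c
mountain-++⁻ˡ b {c} (as , bs , eq , as≤ , bs≥) with ++-equidivisible c b as bs eq
... | inj₁ (e , refl , _)    = c , [] , sym (++-identityʳ c) , proj₁ (AllPairs-++⁻ c as≤) , []
... | inj₂ (e , refl , refl) = as , e , refl , as≤ , proj₁ (AllPairs-++⁻ e bs≥)

mountain-attach⁻ : ∀ s b {c} → Mountain (attach s b c) → Mountain c
mountain-attach⁻ left  b = mountain-++⁻ʳ b
mountain-attach⁻ right b = mountain-++⁻ˡ b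

layered⇒mountain : ∀ {m c} → Layered m c → Mountain c
layered⇒mountain [] = [] , [] , refl , [] , []
layered⇒mountain (layer left {x} {k} _ x<c layered) with layered⇒mountain layered
... | as , bs , refl , as≤ , bs≥ =
  replicate k x ++ as , bs , sym (++-assoc _ as bs) ,
  AllPairs.++⁺ (AllPairs-replicate k ≤-refl) as≤
    (All.replicate⁺ k (All.map <⇒≤ (All.++⁻ˡ as x<c))) ,
  bs≥
layered⇒mountain (layer right {x} {k} _ x<c layered) with layered⇒mountain layered
... | as , bs , refl , as≤ , bs≥ =
  as , bs ++ replicate k x , ++-assoc as bs _ , as≤ ,
  AllPairs.++⁺ bs≥ (AllPairs-replicate k ≤-refl)
    (All.map (λ x<y → All.replicate⁺ k (<⇒≤ x<y)) (All.++⁻ʳ as x<c))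

minimum-at-end : ∀ {c} → c ≢ [] → Mountain c →
                 ∃₂ λ s x → ∃ λ t → c ≡ attach s [ x ] t × All (x ≤_) t
minimum-at-end c≢[] (a ∷ as , bs , refl , a≤as ∷ _ , bs≥) with initLast bs
... | [] = left , a , as ++ [] , refl , All.++⁺ a≤as []
... | bs′ ∷ʳ′ l with a ≤? l
...   | yes a≤l =
  left , a , as ++ bs′ ∷ʳ l , refl ,
  All.++⁺ a≤as (All.∷ʳ⁺ (All.map (≤-trans a≤l) (AllPairs-∷ʳ⁻ bs′ bs≥)) a≤l)
...   | no a≰l =
  right , l , a ∷ as ++ bs′ , cong (a ∷_) (sym (++-assoc as bs′ [ l ])) ,
  <⇒≤ l<a ∷ All.++⁺ (All.map (λ a≤z → <⇒≤ (<-≤-trans l<a a≤z)) a≤as)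
                    (AllPairs-∷ʳ⁻ bs′ bs≥)
  where
    l<a : l < a
    l<a = ≰⇒> a≰l
minimum-at-end c≢[] ([] , bs , refl , _ , bs≥) with initLast bs
... | []        = ⊥-elim (c≢[] refl)
... | bs′ ∷ʳ′ l = right , l , bs′ , refl , AllPairs-∷ʳ⁻ bs′ bs≥

block-at-end : ∀ {m} s {x t c} → SingleBlocks m c → c ≡ attach s [ x ] t →
            ∃₂ λ k rest → c ≡ attach s (replicate k x) rest × x ∉ rest × ¬ m ∣ k
block-at-end left {x} sb refl with sb x (here refl)
... | []      , k , post , eq , _     , x∉post , m∤k = k , post , eq , x∉post , m∤k
... | z ∷ pre , _ , _    , eq , x∉pre , _      , _   =
  ⊥-elim (x∉pre (here (∷-injectiveˡ eq)))
block-at-end right {x} {t} sb refl with sb x (∈-++⁺ʳ t (here refl))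
... | pre , k , post , eq , x∉pre , x∉post , m∤k with initLast post
...   | [] = k , pre , trans eq (cong (pre ++_) (++-identityʳ _)) , x∉pre , m∤k
...   | post′ ∷ʳ′ z = ⊥-elim (x∉post (∈-++⁺ʳ post′ (here (sym z≡x))))
  where
    z≡x : z ≡ x
    z≡x = ∷ʳ-injectiveʳ (pre ++ replicate k x ++ post′) t
            (trans (trans (++-assoc pre _ _) (cong (pre ++_) (++-assoc (replicate k x) post′ _)))
                   (sym eq))

above-minimum : ∀ s {x t c} b {rest} → c ≡ attach s [ x ] t → All (x ≤_) t →
                c ≡ attach s b rest → x ∉ rest → All (x <_) rest
above-minimum s {x} {t} b {rest} c≡ x≤t c≡′ x∉rest = All.tabulate above
  where
    above : ∀ {y} → y ∈ rest → x < y
    above {y} y∈rest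
      with ∈-attach⁻ s [ x ] t (subst (y ∈_) (trans (sym c≡′) c≡) (∈-attach⁺ʳ s b y∈rest))
    ... | inj₁ (here refl) = ⊥-elim (x∉rest y∈rest)
    ... | inj₂ y∈t =
      ≤∧≢⇒< (All.lookup x≤t y∈t) (λ x≡y → x∉rest (subst (_∈ rest) (sym x≡y) y∈rest))

mountain∧singleBlocks⇒layered : ∀ {m c} → Acc _<_ (length c) →
                                Mountain c → SingleBlocks m c → Layered m c
mountain∧singleBlocks⇒layered {c = []}    _ _ _ = []
mountain∧singleBlocks⇒layered {m} {c = a ∷ c} (acc rec) mountain sb
  with minimum-at-end (λ ()) mountain
... | s , x , t , c≡ , x≤t with block-at-end s sb c≡
...   | zero  , _    , _   , _      , m∤0 = ⊥-elim (m∤0 (m ∣0))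
...   | suc k , rest , c≡′ , x∉rest , m∤k =
  subst (Layered m) (sym c≡′)
    (layer s m∤k (above-minimum s block c≡ x≤t c≡′ x∉rest)
      (mountain∧singleBlocks⇒layered (rec shorter)
        (mountain-attach⁻ s block (subst Mountain c≡′ mountain))
        (SingleBlocks-attach⁻ s (∉⇒Disjoint-replicate (suc k) x∉rest) (subst (SingleBlocks m) c≡′ sb))))
  where
    block : List ℕ
    block = replicate (suc k) x
    shorter : length rest < length (a ∷ c)
    shorter = subst (length rest <_) (sym (trans (cong length c≡′) (length-attach s block rest)))
                (s≤s (m≤n+m (length rest) _))

sum-ones : ∀ j → sum (replicate j 1) ≡ j
sum-ones zero    = refl
sum-ones (suc j) = cong suc (sum-ones j)

sum-attach : ∀ s b c → sum (attach s b c) ≡ sum b + sum c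
sum-attach left  b c = sum-++ b c
sum-attach right b c = trans (sum-++ c b) (+-comm (sum c) (sum b))

sum-attach-ones : ∀ s j c → sum (attach s (replicate j 1) c) ≡ j + sum c
sum-attach-ones s j c = trans (sum-attach s (replicate j 1) c) (cong (_+ sum c) (sum-ones j))

sum-scale : ∀ m c → sum (map (m *_) c) ≡ m * sum c
sum-scale m []      = sym (*-zeroʳ m)
sum-scale m (x ∷ c) = trans (cong (m * x +_) (sum-scale m c)) (sym (*-distribˡ-+ m x (sum c)))

∣-sum : ∀ {d c} → All (d ∣_) c → d ∣ sum c
∣-sum []         = _ ∣0
∣-sum (d∣x ∷ d∣c) = ∣m∣n⇒∣m+n d∣x (∣-sum d∣c)

∈⇒≤sum : ∀ {x c} → x ∈ c → x ≤ sum c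
∈⇒≤sum {c = y ∷ c} (here refl) = m≤m+n y (sum c)
∈⇒≤sum {c = y ∷ c} (there x∈c) = ≤-trans (∈⇒≤sum x∈c) (m≤n+m (sum c) y)

module _ {m : ℕ} where

  power≢1⇒∣ : ∀ {x} → IsPowerOf m x → x ≢ 1 → m ∣ x
  power≢1⇒∣ (zero  , refl) x≢1 = ⊥-elim (x≢1 refl)
  power≢1⇒∣ (suc e , refl) _   = m∣m*n (m ^ e)

  power-scale : ∀ {x} → IsPowerOf m x → IsPowerOf m (m * x)
  power-scale (e , refl) = suc e , refl

  module _ .{{_ : NonZero m}} where

    power-positive : ∀ {x} → IsPowerOf m x → 1 ≤ x
    power-positive (e , refl) = m^n>0 m e

    power≢1⇒>1 : ∀ {x} → IsPowerOf m x → x ≢ 1 → 1 < x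
    power≢1⇒>1 px x≢1 = ≤∧≢⇒< (power-positive px) (x≢1 ∘ sym)

    power<base⇒≡1 : ∀ {x} → IsPowerOf m x → x < m → x ≡ 1
    power<base⇒≡1 (zero  , refl) _   = refl
    power<base⇒≡1 (suc e , refl) x<m = ⊥-elim (<⇒≱ x<m (m≤m*n m (m ^ e) {{m^n≢0 m e}}))

    power-quotient : ∀ {x} → IsPowerOf m x → x ≢ 1 → IsPowerOf m (x / m)
    power-quotient (zero  , refl) x≢1 = ⊥-elim (x≢1 refl)
    power-quotient (suc e , refl) _   = e , sym (trans (cong (_/ m) (*-comm m (m ^ e))) (m*n/n≡m (m ^ e) m))

layered-map : ∀ {m} (f : ℕ → ℕ) (P : ℕ → Set) → (∀ {x y} → P x → P y → x < y → f x < f y) →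
              ∀ {c} → All P c → Layered m c → Layered m (map f c)
layered-map f P mono _  [] = []
layered-map f P mono _  (layer s {k = zero} m∤0 _ _) = ⊥-elim (m∤0 (_ ∣0))
layered-map {m} f P mono pc (layer s {x} {suc k} {c} m∤k x<c layered) =
  subst (Layered m) (sym (trans (map-attach f s _ c)
                                (cong (λ b → attach s b (map f c)) (map-replicate f (suc k) x))))
    (layer s m∤k (All.map⁺ (All.zipWith (λ (py , x<y) → mono px py x<y) (pc′ , x<c)))
      (layered-map f P mono pc′ layered))
  where
    px : P x
    px = All.replicate⁻ (proj₁ (All-attach⁻ s (replicate (suc k) x) pc))
    pc′ : All P c
    pc′ = proj₂ (All-attach⁻ s (replicate (suc k) x) pc)

record Admissible (m : ℕ) (c : List ℕ) : Set where
  constructor admissible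
  field
    powers  : All (IsPowerOf m) c
    layered : Layered m c

admissible⇒oc : ∀ {n m c} .{{_ : NonZero m}} → sum c ≡ n → Admissible m c → OC n m c
admissible⇒oc sum≡ (admissible powers layered) =
  (All.map power-positive powers , sum≡) , powers ,
  mountain⇒weaklyUnimodal (layered⇒mountain layered) , layered⇒singleBlocks layered

oc⇒admissible : ∀ {n m c} → OC n m c → sum c ≡ n × Admissible m c
oc⇒admissible ((_ , sum≡) , powers , unimodal , blocks) =
  sum≡ , admissible powers
           (mountain∧singleBlocks⇒layered (<-wellFounded _) (weaklyUnimodal⇒mountain unimodal) blocks)

data OnesBlock (m j : ℕ) : List ℕ → Set where
  onesBlock : ∀ s {c} → ¬ m ∣ j → All (1 <_) c → Admissible m c →
              OnesBlock m j (attach s (replicate j 1) c)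

ones : List ℕ → ℕ
ones c = length (filter (_≟ 1) c)

ones-attach-ones : ∀ s j {c} → All (1 <_) c → ones (attach s (replicate j 1) c) ≡ j
ones-attach-ones s j {c} 1<c = begin
  length (filter (_≟ 1) (attach s (replicate j 1) c))
    ≡⟨ cong length (filter-attach s) ⟩
  length (attach s (filter (_≟ 1) (replicate j 1)) (filter (_≟ 1) c))
    ≡⟨ length-attach s _ _ ⟩
  length (filter (_≟ 1) (replicate j 1)) + length (filter (_≟ 1) c)
    ≡⟨ cong₂ (λ b c → length b + length c) (filter-all (_≟ 1) (All.replicate⁺ j refl))
                                           (filter-none (_≟ 1) (All.map >⇒≢ 1<c)) ⟩
  length (replicate j 1) + 0
    ≡⟨ trans (+-identityʳ _) (length-replicate j) ⟩
  j ∎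
  where
    open ≡-Reasoning
    filter-attach : ∀ s {b c} →
                    filter (_≟ 1) (attach s b c) ≡ attach s (filter (_≟ 1) b) (filter (_≟ 1) c)
    filter-attach left  {b} {c} = filter-++ (_≟ 1) b c
    filter-attach right {b} {c} = filter-++ (_≟ 1) c b

module _ {m : ℕ} where

  onesBlock⇒admissible : ∀ {j c} → OnesBlock m j c → Admissible m c
  onesBlock⇒admissible {j} (onesBlock s m∤j 1<c (admissible powers layered)) =
    admissible (All-attach⁺ s (All.replicate⁺ j (0 , refl)) powers) (layer s m∤j 1<c layered)

  ones-onesBlock : ∀ {j c} → OnesBlock m j c → ones c ≡ j
  ones-onesBlock {j} (onesBlock s _ 1<c _) = ones-attach-ones s j 1<c

  all>1⇒divisible : ∀ {c} → All (IsPowerOf m) c → All (1 <_) c → All (m ∣_) c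
  all>1⇒divisible powers 1<c =
    All.zipWith (λ (px , 1<x) → power≢1⇒∣ px (>⇒≢ 1<x)) (powers , 1<c)

  all>1⇒∣sum : ∀ {c} → All (IsPowerOf m) c → All (1 <_) c → m ∣ sum c
  all>1⇒∣sum powers 1<c = ∣-sum (all>1⇒divisible powers 1<c)

  -- The outermost layer holds the smallest part, so the 1s, if any, form that layer.
  ones-or-none : .{{_ : NonZero m}} → ∀ {c} → Admissible m c → All (1 <_) c ⊎ ∃ λ j → OnesBlock m j c
  ones-or-none (admissible _ []) = inj₁ []
  ones-or-none (admissible _ (layer s {k = zero} m∤0 _ _)) = ⊥-elim (m∤0 (m ∣0))
  ones-or-none (admissible powers (layer s {x} {suc k} m∤k x<c layered)) with x ≟ 1
  ... | yes refl =
    inj₂ (suc k , onesBlock s m∤k x<c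
                    (admissible (proj₂ (All-attach⁻ s (replicate (suc k) 1) powers)) layered))
  ... | no x≢1   = inj₁ (All-attach⁺ s (All.replicate⁺ (suc k) 1<x) (All.map (<-trans 1<x) x<c))
    where
      1<x : 1 < x
      1<x = power≢1⇒>1 (All.replicate⁻ (proj₁ (All-attach⁻ s (replicate (suc k) x) powers))) x≢1

  ∣sum⇒all>1 : .{{_ : NonZero m}} → ∀ {c} → Admissible m c → m ∣ sum c → All (1 <_) c
  ∣sum⇒all>1 v m∣sum with ones-or-none v
  ... | inj₁ 1<c = 1<c
  ... | inj₂ (j , onesBlock s {c} m∤j 1<c (admissible powers _)) =
    ⊥-elim (m∤j (∣m+n∣m⇒∣n (subst (m ∣_) (trans (sum-attach-ones s j c) (+-comm j (sum c))) m∣sum)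
                           (all>1⇒∣sum powers 1<c)))

  ∤sum⇒onesBlock : .{{_ : NonZero m}} → ∀ {c} → Admissible m c → ¬ m ∣ sum c →
                   ∃ λ j → OnesBlock m j c
  ∤sum⇒onesBlock v m∤sum with ones-or-none v
  ... | inj₁ 1<c   = ⊥-elim (m∤sum (all>1⇒∣sum (Admissible.powers v) 1<c))
  ... | inj₂ block = block

module _ {m : ℕ} .{{_ : NonZero m}} where

  admissible-scale : ∀ {d} → Admissible m d → Admissible m (map (m *_) d)
  admissible-scale (admissible powers layered) =
    admissible (All.map⁺ (All.map power-scale powers))
               (layered-map (m *_) (λ _ → ⊤) (λ _ _ → *-monoʳ-< m) (All.map (λ _ → tt) powers) layered)

  /-mono-<-∣ : ∀ {x y} → m ∣ x → m ∣ y → x < y → x / m < y / m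
  /-mono-<-∣ m∣x m∣y x<y =
    *-cancelˡ-< m _ _ (subst₂ _<_ (sym (m*[n/m]≡n m∣x)) (sym (m*[n/m]≡n m∣y)) x<y)

  admissible-unscale : ∀ {c} → All (1 <_) c → Admissible m c → Admissible m (map (_/ m) c)
  admissible-unscale 1<c (admissible powers layered) =
    admissible (All.map⁺ (All.zipWith (λ (px , 1<x) → power-quotient px (>⇒≢ 1<x)) (powers , 1<c)))
               (layered-map (_/ m) (m ∣_) /-mono-<-∣ (all>1⇒divisible powers 1<c) layered)

  scale-unscale : ∀ {c} → All (m ∣_) c → map (m *_) (map (_/ m) c) ≡ c
  scale-unscale {c} m∣c = trans (sym (map-∘ c)) (map-id-local (All.map m*[n/m]≡n m∣c))

record Enumerates (m n : ℕ) (L : List (List ℕ)) : Set where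
  field
    sound    : ∀ {c} → c ∈ L → sum c ≡ n × Admissible m c
    complete : ∀ {c} → sum c ≡ n → Admissible m c → c ∈ L
    unique   : Unique L

enumerates⇒hasCardinality : ∀ {m n L} .{{_ : NonZero m}} → Enumerates m n L →
                            HasCardinality (OC n m) (length L)
enumerates⇒hasCardinality {L = L} e =
  L , unique ,
  (λ c c∈L → let sum≡ , v = sound c∈L in admissible⇒oc sum≡ v) ,
  (λ c oc → let sum≡ , v = oc⇒admissible oc in complete sum≡ v) ,
  refl
  where open Enumerates e

module _ {A : Set} where

  at-both-ends : List A → List (List A) → List (List A)
  at-both-ends b D = map (attach left b) D ++ map (attach right b) D

  ∈-at-both-ends⁺ : ∀ s {b d D} → d ∈ D → attach s b d ∈ at-both-ends b D
  ∈-at-both-ends⁺ left  d∈D = ∈-++⁺ˡ (∈-map⁺ _ d∈D)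
  ∈-at-both-ends⁺ right d∈D = ∈-++⁺ʳ _ (∈-map⁺ _ d∈D)

  ∈-at-both-ends⁻ : ∀ {b c} D → c ∈ at-both-ends b D → ∃₂ λ s d → d ∈ D × c ≡ attach s b d
  ∈-at-both-ends⁻ D c∈ with ∈-++⁻ (map _ D) c∈
  ... | inj₁ c∈ˡ = let d , d∈D , c≡ = ∈-map⁻ _ c∈ˡ in left  , d , d∈D , c≡
  ... | inj₂ c∈ʳ = let d , d∈D , c≡ = ∈-map⁻ _ c∈ʳ in right , d , d∈D , c≡

  length-at-both-ends : ∀ b D → length (at-both-ends b D) ≡ 2 * length D
  length-at-both-ends b D =
    trans (length-++ (map (attach left b) D))
          (cong₂ _+_ (length-map _ D) (trans (length-map _ D) (sym (+-identityʳ _))))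

  unique-at-both-ends : ∀ {b D} → Unique D → (∀ {d d′} → d ∈ D → d′ ∈ D → b ++ d ≢ d′ ++ b) →
                        Unique (at-both-ends b D)
  unique-at-both-ends {b} {D} unique left≢right =
    Unique.++⁺ (Unique.map⁺ (attach-cancel left b) unique) (Unique.map⁺ (attach-cancel right b) unique)
      λ (c∈ˡ , c∈ʳ) → let d , d∈D , c≡ = ∈-map⁻ _ c∈ˡ ; d′ , d′∈D , c≡′ = ∈-map⁻ _ c∈ʳ in
        left≢right d∈D d′∈D (trans (sym c≡) c≡′)

ones-front≢back : ∀ {r} d {d′} → r ≢ 0 → d′ ≢ [] → All (1 <_) d′ →
                  replicate r 1 ++ d ≢ d′ ++ replicate r 1
ones-front≢back {zero}  d      r≢0 _     _          = ⊥-elim (r≢0 refl)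
ones-front≢back {suc r} d {[]} _   d′≢[] _          = ⊥-elim (d′≢[] refl)
ones-front≢back {suc r} d {y ∷ d′} _ _   (1<y ∷ _) eq = <-irrefl (∷-injectiveˡ eq) 1<y

all-ones : ∀ {c} → All (_≡ 1) c → c ≡ replicate (sum c) 1
all-ones []           = refl
all-ones (refl ∷ c≡1) = cong (1 ∷_) (all-ones c≡1)

layered-ones : ∀ {m n} → n < m → Layered m (replicate n 1)
layered-ones {n = zero}  _   = []
layered-ones {m} {suc n} n<m = subst (Layered m) (++-identityʳ _) (layer left (>⇒∤ n<m) [] [])

module _ {m : ℕ} .{{_ : NonZero m}} where

  enumerates-small : ∀ {n} → n < m → Enumerates m n [ replicate n 1 ]
  enumerates-small {n} n<m = record { sound = sound ; complete = complete ; unique = [] ∷ [] }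
    where
      sound : ∀ {c} → c ∈ [ replicate n 1 ] → sum c ≡ n × Admissible m c
      sound (here refl) = sum-ones n , admissible (All.replicate⁺ n (0 , refl)) (layered-ones n<m)
      complete : ∀ {c} → sum c ≡ n → Admissible m c → c ∈ [ replicate n 1 ]
      complete {c} sum≡ (admissible powers _) =
        here (trans (all-ones (All.tabulate all-1)) (cong (λ i → replicate i 1) sum≡))
        where
          all-1 : ∀ {x} → x ∈ c → x ≡ 1
          all-1 x∈c = power<base⇒≡1 (All.lookup powers x∈c)
                                     (≤-<-trans (∈⇒≤sum x∈c) (subst (_< m) (sym sum≡) n<m))

  enumerates-scaled : ∀ {n G} → m ∣ n → Enumerates m (n / m) G → Enumerates m n (map (map (m *_)) G)
  enumerates-scaled {n} {G} m∣n EG = record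
    { sound    = sound
    ; complete = complete
    ; unique   = Unique.map⁺ (map-injective (λ {x} {y} → *-cancelˡ-≡ x y m)) (Enumerates.unique EG)
    }
    where
      sound : ∀ {c} → c ∈ map (map (m *_)) G → sum c ≡ n × Admissible m c
      sound c∈ with ∈-map⁻ (map (m *_)) c∈
      ... | d , d∈G , refl =
        let sum≡ , v = Enumerates.sound EG d∈G in
        trans (sum-scale m d) (trans (cong (m *_) sum≡) (m*[n/m]≡n m∣n)) , admissible-scale v
      complete : ∀ {c} → sum c ≡ n → Admissible m c → c ∈ map (map (m *_)) G
      complete {c} sum≡ v =
        subst (_∈ _) (scale-unscale m∣c)
          (∈-map⁺ (map (m *_)) (Enumerates.complete EG sum-unscaled (admissible-unscale 1<c v)))
        where
          1<c : All (1 <_) c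
          1<c = ∣sum⇒all>1 v (subst (m ∣_) (sym sum≡) m∣n)
          m∣c : All (m ∣_) c
          m∣c = all>1⇒divisible (Admissible.powers v) 1<c
          sum-unscaled : sum (map (_/ m) c) ≡ n / m
          sum-unscaled = *-cancelˡ-≡ _ _ m (begin
            m * sum (map (_/ m) c)          ≡⟨ sym (sum-scale m (map (_/ m) c)) ⟩
            sum (map (m *_) (map (_/ m) c)) ≡⟨ cong sum (scale-unscale m∣c) ⟩
            sum c                           ≡⟨ sum≡ ⟩
            n                               ≡⟨ sym (m*[n/m]≡n m∣n) ⟩
            m * (n / m)                     ∎)
            where open ≡-Reasoning

module Counting (k : ℕ) where

  m : ℕ
  m = 2 + k

  addOnes : List ℕ → List ℕ
  addOnes (1 ∷ c) = replicate m 1 ++ 1 ∷ c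
  addOnes c       = c ++ replicate m 1

  addOnes-attach : ∀ s j {c} → All (1 <_) c →
                   addOnes (attach s (replicate (suc j) 1) c) ≡ attach s (replicate (m + suc j) 1) c
  addOnes-attach left j {c} _ =
    trans (sym (++-assoc (replicate m 1) (replicate (suc j) 1) c))
          (cong (_++ c) (replicate-++ 1 m (suc j)))
  addOnes-attach right j {[]} _ = replicate-++ 1 m (suc j)
  addOnes-attach right j {c@(suc (suc _) ∷ _)} _ =
    trans (++-assoc c (replicate (suc j) 1) (replicate m 1))
          (cong (c ++_) (trans (replicate-++ 1 (suc j) m) (cong (λ i → replicate i 1) (+-comm (suc j) m))))
  addOnes-attach right j {suc zero ∷ _} (s≤s () ∷ _)
  addOnes-attach right j {zero ∷ _}     (() ∷ _)

  data AddOnesView : List ℕ → Set where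
    ones-first : ∀ t → AddOnesView (1 ∷ t)
    ones-last  : ∀ {c} → addOnes c ≡ c ++ replicate m 1 → (∀ t → c ≢ 1 ∷ t) → AddOnesView c

  addOnesView : ∀ c → AddOnesView c
  addOnesView []                = ones-last refl (λ _ ())
  addOnesView (zero ∷ t)        = ones-last refl (λ _ ())
  addOnesView (suc zero ∷ t)    = ones-first t
  addOnesView (suc (suc x) ∷ t) = ones-last refl (λ _ ())

  ones-first≢ones-last : ∀ t {b} → (∀ u → b ≢ 1 ∷ u) → replicate m 1 ++ 1 ∷ t ≢ b ++ replicate m 1
  ones-first≢ones-last t {[]}    _  eq
    with ++-cancelˡ (replicate m 1) (1 ∷ t) [] (trans eq (sym (++-identityʳ _)))
  ... | ()
  ones-first≢ones-last t {z ∷ u} b≢ eq with ∷-injectiveˡ eq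
  ... | refl = b≢ u refl

  addOnes-injective : ∀ {a b} → addOnes a ≡ addOnes b → a ≡ b
  addOnes-injective {a} {b} eq with addOnesView a | addOnesView b
  ... | ones-first _    | ones-first _    = ++-cancelˡ (replicate m 1) _ _ eq
  ... | ones-last ea _  | ones-last eb _  = ++-cancelʳ (replicate m 1) a b (trans (sym ea) (trans eq eb))
  ... | ones-first t    | ones-last eb b≢ = ⊥-elim (ones-first≢ones-last t b≢ (trans eq eb))
  ... | ones-last ea a≢ | ones-first t    = ⊥-elim (ones-first≢ones-last t a≢ (trans (sym eq) ea))

  module NonDivisible {n} (m≤n : m ≤ n) (r≢0 : n % m ≢ 0) {A B : List (List ℕ)}
                      (EA : Enumerates m (n ∸ n % m) A) (EB : Enumerates m (n ∸ m) B) where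

    r : ℕ
    r = n % m

    Sided Grown : List (List ℕ)
    Sided = at-both-ends (replicate r 1) A
    Grown = map addOnes B

    r<m : r < m
    r<m = m%n<n n m

    m∤r : ¬ m ∣ r
    m∤r = >⇒∤ {{≢-nonZero r≢0}} r<m

    r+[n∸r]≡n : r + (n ∸ r) ≡ n
    r+[n∸r]≡n = m+[n∸m]≡n (m%n≤m n m)

    m∣n∸r : m ∣ n ∸ r
    m∣n∸r = divides (n / m) (trans (cong (_∸ r) (m≡m%n+[m/n]*n n m)) (m+n∸m≡n r _))

    m∤n : ¬ m ∣ n
    m∤n m∣n = r≢0 (n∣m⇒m%n≡0 n m m∣n)

    m∤n∸m : ¬ m ∣ n ∸ m
    m∤n∸m m∣n∸m = m∤n (subst (m ∣_) (m+[n∸m]≡n m≤n) (∣m∣n⇒∣m+n n∣n m∣n∸m))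

    sided-block : ∀ {c} → c ∈ Sided → sum c ≡ n × OnesBlock m r c
    sided-block c∈Sided with ∈-at-both-ends⁻ A c∈Sided
    ... | s , d , d∈A , refl =
      let sum≡ , v = Enumerates.sound EA d∈A in
      trans (sum-attach-ones s r d) (trans (cong (r +_) sum≡) r+[n∸r]≡n) ,
      onesBlock s m∤r (∣sum⇒all>1 v (subst (m ∣_) (sym sum≡) m∣n∸r)) v

    grown-block : ∀ {c} → c ∈ Grown → sum c ≡ n × ∃ λ j → m ≤ j × OnesBlock m j c
    grown-block c∈Grown with ∈-map⁻ addOnes c∈Grown
    ... | d , d∈B , refl with Enumerates.sound EB d∈B
    ...   | sum≡ , v with ∤sum⇒onesBlock v (m∤n∸m ∘ subst (m ∣_) sum≡)
    ...     | zero  , onesBlock s m∤0 _ _ = ⊥-elim (m∤0 (m ∣0))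
    ...     | suc j , onesBlock s {d′} m∤j 1<d′ v′ =
      subst (λ c → sum c ≡ n × ∃ λ j → m ≤ j × OnesBlock m j c) (sym (addOnes-attach s j 1<d′))
        (sum-added , m + suc j , m≤m+n m (suc j) , onesBlock s (m∤j⇒m∤m+j m∤j) 1<d′ v′)
      where
        open ≡-Reasoning
        sum-added : sum (attach s (replicate (m + suc j) 1) d′) ≡ n
        sum-added = begin
          sum (attach s (replicate (m + suc j) 1) d′)
            ≡⟨ sum-attach-ones s (m + suc j) d′ ⟩
          m + suc j + sum d′
            ≡⟨ +-assoc m (suc j) (sum d′) ⟩
          m + (suc j + sum d′)
            ≡⟨ cong (m +_) (sym (sum-attach-ones s (suc j) d′)) ⟩
          m + sum (attach s (replicate (suc j) 1) d′)
            ≡⟨ cong (m +_) sum≡ ⟩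
          m + (n ∸ m)
            ≡⟨ m+[n∸m]≡n m≤n ⟩
          n ∎

    complete : ∀ {c} → sum c ≡ n → Admissible m c → c ∈ Sided ++ Grown
    complete sum≡ v with ∤sum⇒onesBlock v (m∤n ∘ subst (m ∣_) sum≡)
    ... | j , onesBlock s {c′} m∤j 1<c′ v′ with j <? m
    ...   | yes j<m =
      ∈-++⁺ˡ (subst (λ i → attach s (replicate i 1) c′ ∈ Sided) r≡j
                    (∈-at-both-ends⁺ s (Enumerates.complete EA sum-c′ v′)))
      where
        j+c′≡n : j + sum c′ ≡ n
        j+c′≡n = trans (sym (sum-attach-ones s j c′)) sum≡
        r≡j : r ≡ j
        r≡j = trans (cong (_% m) (sym j+c′≡n))
                    ([j+s]%m≡j (all>1⇒∣sum (Admissible.powers v′) 1<c′) j<m)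
        sum-c′ : sum c′ ≡ n ∸ r
        sum-c′ = sym (trans (cong₂ _∸_ (sym j+c′≡n) r≡j) (m+n∸m≡n j (sum c′)))
    ...   | no j≮m with m≤n⇒∃[o]m+o≡n (≮⇒≥ j≮m)
    ...     | zero  , refl = ⊥-elim (m∤j (subst (m ∣_) (sym (+-identityʳ m)) n∣n))
    ...     | suc i , refl =
      ∈-++⁺ʳ Sided (subst (_∈ Grown) (addOnes-attach s i 1<c′)
                          (∈-map⁺ addOnes (Enumerates.complete EB sum-shrunk (onesBlock⇒admissible shrunk))))
      where
        shrunk : OnesBlock m (suc i) (attach s (replicate (suc i) 1) c′)
        shrunk = onesBlock s (m∤j ∘ ∣m∣n⇒∣m+n n∣n) 1<c′ v′
        open ≡-Reasoning
        sum-shrunk : sum (attach s (replicate (suc i) 1) c′) ≡ n ∸ m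
        sum-shrunk = begin
          sum (attach s (replicate (suc i) 1) c′)
            ≡⟨ sum-attach-ones s (suc i) c′ ⟩
          suc i + sum c′
            ≡⟨ sym (m+n∸m≡n m _) ⟩
          m + (suc i + sum c′) ∸ m
            ≡⟨ cong (_∸ m) (sym (+-assoc m (suc i) (sum c′))) ⟩
          m + suc i + sum c′ ∸ m
            ≡⟨ cong (_∸ m) (sym (sum-attach-ones s (m + suc i) c′)) ⟩
          sum (attach s (replicate (m + suc i) 1) c′) ∸ m
            ≡⟨ cong (_∸ m) sum≡ ⟩
          n ∸ m ∎

    nonempty : ∀ {d} → sum d ≡ n ∸ r → d ≢ []
    nonempty sum≡ refl = <⇒≱ r<m (≤-trans m≤n (m∸n≡0⇒m≤n (sym sum≡)))

    -- Elements of Sided contain exactly r < m ones, elements of Grown at least m.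
    sided#grown : Disjoint Sided Grown
    sided#grown (c∈Sided , c∈Grown) with sided-block c∈Sided | grown-block c∈Grown
    ... | _ , r-block | _ , j , m≤j , j-block =
      <⇒≱ r<m (subst (m ≤_) (trans (sym (ones-onesBlock j-block)) (ones-onesBlock r-block)) m≤j)

    unique : Unique (Sided ++ Grown)
    unique = Unique.++⁺ (unique-at-both-ends (Enumerates.unique EA) left≢right)
                        (Unique.map⁺ addOnes-injective (Enumerates.unique EB)) sided#grown
      where
        left≢right : ∀ {d d′} → d ∈ A → d′ ∈ A → replicate r 1 ++ d ≢ d′ ++ replicate r 1
        left≢right {d} _ d′∈A =
          let sum≡ , v = Enumerates.sound EA d′∈A in
          ones-front≢back d r≢0 (nonempty sum≡) (∣sum⇒all>1 v (subst (m ∣_) (sym sum≡) m∣n∸r))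

    sound : ∀ {c} → c ∈ Sided ++ Grown → sum c ≡ n × Admissible m c
    sound c∈ with ∈-++⁻ Sided c∈
    ... | inj₁ c∈Sided = let sum≡ , block = sided-block c∈Sided in sum≡ , onesBlock⇒admissible block
    ... | inj₂ c∈Grown = let sum≡ , _ , _ , block = grown-block c∈Grown in sum≡ , onesBlock⇒admissible block

    enumerates : Enumerates m n (Sided ++ Grown)
    enumerates = record { sound = sound ; complete = complete ; unique = unique }

  enumerate : ℕ → ℕ → List (List ℕ)
  enumerate zero    n = [ [] ]
  enumerate (suc f) n =
    if n <ᵇ m then [ replicate n 1 ]
    else if n % m ≡ᵇ 0 then map (map (m *_)) (enumerate f (n / m))
    else at-both-ends (replicate (n % m) 1) (enumerate f (n ∸ n % m))
         ++ map addOnes (enumerate f (n ∸ m))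

  length-enumerate : ∀ f n → length (enumerate f n) ≡ spF f n k
  length-enumerate zero    n = refl
  length-enumerate (suc f) n with n <ᵇ m
  ... | true  = refl
  ... | false with n % m ≡ᵇ 0
  ...   | true  = trans (length-map _ (enumerate f (n / m))) (length-enumerate f (n / m))
  ...   | false =
    trans (length-++ (at-both-ends (replicate (n % m) 1) (enumerate f (n ∸ n % m))))
          (cong₂ _+_ (trans (length-at-both-ends (replicate (n % m) 1) (enumerate f (n ∸ n % m)))
                            (cong (2 *_) (length-enumerate f (n ∸ n % m))))
                     (trans (length-map addOnes (enumerate f (n ∸ m))) (length-enumerate f (n ∸ m))))

  enumerate-correct : ∀ f n → n ≤ f → Enumerates m n (enumerate f n)
  enumerate-correct zero    zero _ = enumerates-small (s≤s z≤n)
  enumerate-correct (suc f) n n≤f with n <ᵇ m | <ᵇ-reflects-< n m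
  ... | true  | ofʸ n<m = enumerates-small n<m
  ... | false | ofⁿ n≮m with n % m ≡ᵇ 0 | ≡ᵇ-reflects-≡ (n % m) 0
  ...   | true  | ofʸ r≡0 =
    enumerates-scaled (m%n≡0⇒n∣m n m r≡0)
      (enumerate-correct f (n / m) (m<n≤1+o⇒m≤o n/m<n n≤f))
    where
      n/m<n : n / m < n
      n/m<n = m/n<m n m {{>-nonZero (<-≤-trans z<s (≮⇒≥ n≮m))}} (s≤s (s≤s z≤n))
  ...   | false | ofⁿ r≢0 =
    NonDivisible.enumerates (≮⇒≥ n≮m) r≢0
      (enumerate-correct f (n ∸ n % m) (m<n≤1+o⇒m≤o n∸r<n n≤f))
      (enumerate-correct f (n ∸ m) (m<n≤1+o⇒m≤o (∸-monoʳ-< z<s (≮⇒≥ n≮m)) n≤f))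
    where
      n∸r<n : n ∸ n % m < n
      n∸r<n = ∸-monoʳ-< (≤∧≢⇒< z≤n (r≢0 ∘ sym)) (m%n≤m n m)

theorem2p2 : ∀ (n m : ℕ) → 1 < m → HasCardinality (OC n m) (sp n m)
theorem2p2 n (suc zero)    (s≤s ())
theorem2p2 n (suc (suc k)) _ =
  subst (HasCardinality (OC n (2 + k))) (length-enumerate n n)
        (enumerates⇒hasCardinality (enumerate-correct n n ≤-refl))
  where open Counting k
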